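{- Let $s\ge 1$ and let $G$ be a bicyclic graph with vertex set $V(G)=\{u,v,v_1,\dots,v_s\}\cup V(C_p)\cup V(C_q)$, where $C_p$ and $C_q$ are cycles of $G$ sharing exactly one common vertex $w$, $u\in V(C_q)$, $v\notin V(C_p)\cup V(C_q)$ has degree $s+1$, its neighbors are $u$ and $v_1,\dots,v_s$, and $vv_1,\dots,vv_s$ are pendent edges. Let $G'=\sigma(G,v)$ be the graph obtained from $G$ by deleting the edges $vv_1,\dots,vv_s$ and adding the edges $uv_1,\dots,uv_s$. Then $D_R(G)>D_R(G')$.
   Context: All graphs are finite and simple. For vertices $x,y$ of a connected graph $G$, the resistance distance $r(x,y)$ is the effective resistance between $x$ and $y$ in the electrical network obtained from $G$ by replacing every edge by a unit resistor. The degree resistance distance of $G$ is $D_R(G)=\sum_{\{x,y\}\subseteq V(G)}[d(x)+d(y)]\,r(x,y)$, where $d(x)$ is the degree of $x$. A bicyclic graph is a connected graph with $|E(G)|=|V(G)|+1$. A pendent edge is an edge incident with a vertex of degree $1$. -}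

module Defs where

open import Data.Bool using (Bool; true; false; _∧_; _∨_; not; if_then_else_)
open import Data.Bool.Properties using (∨-comm; ∧-zeroʳ)
open import Data.Nat as ℕ using (ℕ; zero; suc)
open import Data.Fin using (Fin; zero; suc; toℕ; inject₁; fromℕ; _≟_; _<?_)
open import Data.Integer using (+_)
open import Data.Rational using (ℚ; 0ℚ; 1ℚ; _+_; _-_; _*_; _/_)
open import Data.Product using (Σ; ∃; _×_; _,_)
open import Data.Sum using (_⊎_)
open import Relation.Nullary.Decidable using (⌊_⌋; yes; no)
open import Relation.Binary.PropositionalEquality using (_≡_; refl; cong; cong₂)
open import Relation.Nullary using (¬_)

record Graph (n : ℕ) : Set where
  field
    adj    : Fin n → Fin n → Bool
    sym    : ∀ x y → adj x y ≡ adj y x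
    irrefl : ∀ x → adj x x ≡ false
open Graph public

Adj : ∀ {n} → Graph n → Fin n → Fin n → Set
Adj G x y = adj G x y ≡ true

sumℕ : ∀ n → (Fin n → ℕ) → ℕ
sumℕ zero    f = 0
sumℕ (suc n) f = f zero ℕ.+ sumℕ n (λ i → f (suc i))

sumℚ : ∀ n → (Fin n → ℚ) → ℚ
sumℚ zero    f = 0ℚ
sumℚ (suc n) f = f zero + sumℚ n (λ i → f (suc i))

b2ℕ : Bool → ℕ
b2ℕ true  = 1
b2ℕ false = 0

ℕtoℚ : ℕ → ℚ
ℕtoℚ k = + k / 1

deg : ∀ {n} → Graph n → Fin n → ℕ
deg {n} G x = sumℕ n (λ y → b2ℕ (adj G x y))

edgeCount : ∀ {n} → Graph n → ℕ
edgeCount {n} G =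
  sumℕ n (λ x → sumℕ n (λ y → b2ℕ (⌊ x <? y ⌋ ∧ adj G x y)))

data Walk {n} (G : Graph n) : Fin n → Fin n → Set where
  [] : ∀ {x} → Walk G x x
  _∷_ : ∀ {x y z} → Adj G x y → Walk G y z → Walk G x z

Connected : ∀ {n} → Graph n → Set
Connected G = ∀ x y → Walk G x y

Bicyclic : ∀ {n} → Graph n → Set
Bicyclic {n} G = Connected G × edgeCount G ≡ suc n

-- A cycle C_p of G, p = suc k ≥ 3: distinct vertices c_0,…,c_k with
-- c_i c_{i+1} and c_k c_0 edges of G.

record Cycle {n} (G : Graph n) (p : ℕ) : Set where
  field
    k      : ℕ
    len    : p ≡ suc k
    len≥3  : 2 ℕ.≤ k
    vert   : Fin (suc k) → Fin n
    inj    : ∀ i j → vert i ≡ vert j → i ≡ j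
    step   : ∀ (i : Fin k) → Adj G (vert (inject₁ i)) (vert (suc i))
    close  : Adj G (vert (fromℕ k)) (vert zero)
open Cycle public

OnCycle : ∀ {n} {G : Graph n} {p} → Cycle G p → Fin n → Set
OnCycle C z = ∃ λ i → vert C i ≡ z

-- Unit current enters at x and leaves at y; a potential φ satisfies
-- Kirchhoff's current law with Ohm's law on unit resistors:
--   Σ_{w ~ z} (φ z - φ w) = [z = x] - [z = y]   for all z.

δ : ∀ {n} → Fin n → Fin n → ℚ
δ a b = if ⌊ a ≟ b ⌋ then 1ℚ else 0ℚ

IsResistance : ∀ {n} → Graph n → Fin n → Fin n → ℚ → Set
IsResistance {n} G x y r =
  Σ (Fin n → ℚ) λ φ →
    (∀ z → sumℚ n (λ w → if adj G z w then φ z - φ w else 0ℚ) ≡ δ z x - δ z y)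
    × r ≡ φ x - φ y

DRsum : ∀ {n} → Graph n → (Fin n → Fin n → ℚ) → ℚ
DRsum {n} G r =
  sumℚ n (λ x → sumℚ n (λ y →
    if ⌊ x <? y ⌋ then ℕtoℚ (deg G x ℕ.+ deg G y) * r x y else 0ℚ))

IsDR : ∀ {n} → Graph n → ℚ → Set
IsDR {n} G D =
  Σ (Fin n → Fin n → ℚ) λ r →
    (∀ x y → IsResistance G x y (r x y)) × D ≡ DRsum G r

-- σ(G,v): delete edges v v_i, add edges u v_i (i = 1..s)

isLeaf : ∀ {n s} → (Fin s → Fin n) → Fin n → Bool
isLeaf {s = zero}  vs z = false
isLeaf {s = suc s} vs z = ⌊ z ≟ vs zero ⌋ ∨ isLeaf (λ i → vs (suc i)) z

σadj : ∀ {n s} → Graph n → Fin n → Fin n → (Fin s → Fin n) → Fin n → Fin n → Bool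
σadj G u v vs x y =
  (adj G x y ∧ not ((⌊ x ≟ v ⌋ ∧ isLeaf vs y) ∨ (⌊ y ≟ v ⌋ ∧ isLeaf vs x)))
  ∨ (((⌊ x ≟ u ⌋ ∧ isLeaf vs y) ∨ (⌊ y ≟ u ⌋ ∧ isLeaf vs x)) ∧ not ⌊ x ≟ y ⌋)

private
  ≟-sym : ∀ {n} (x y : Fin n) → ⌊ x ≟ y ⌋ ≡ ⌊ y ≟ x ⌋
  ≟-sym x y with x ≟ y | y ≟ x
  ... | yes _ | yes _ = refl
  ... | no _  | no _  = refl
  ... | yes refl | no ¬p = Data.Empty.⊥-elim (¬p refl)
    where import Data.Empty
  ... | no ¬p | yes refl = Data.Empty.⊥-elim (¬p refl)
    where import Data.Empty

  ≟-refl : ∀ {n} (x : Fin n) → ⌊ x ≟ x ⌋ ≡ true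
  ≟-refl x with x ≟ x
  ... | yes _ = refl
  ... | no ¬p = Data.Empty.⊥-elim (¬p refl)
    where import Data.Empty

σ : ∀ {n s} → Graph n → (u v : Fin n) → (Fin s → Fin n) → Graph n
σ G u v vs = record
  { adj = σadj G u v vs
  ; sym = λ x y → cong₂ _∨_
      (cong₂ _∧_ (Graph.sym G x y)
        (cong not (∨-comm (⌊ x ≟ v ⌋ ∧ isLeaf vs y) (⌊ y ≟ v ⌋ ∧ isLeaf vs x))))
      (cong₂ _∧_ (∨-comm (⌊ x ≟ u ⌋ ∧ isLeaf vs y) (⌊ y ≟ u ⌋ ∧ isLeaf vs x))
        (cong not (≟-sym x y)))
  ; irrefl = λ x → irr x
  }
  where
  irr : ∀ x → σadj G u v vs x x ≡ false
  irr x rewrite Graph.irrefl G x | ≟-refl x =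
    ∧-zeroʳ ((⌊ x ≟ u ⌋ ∧ isLeaf vs x) ∨ (⌊ x ≟ u ⌋ ∧ isLeaf vs x))

-- Effective resistances exist and are unique: a harmonic function on a connected
-- graph is constant (maximum principle), so by the Fredholm alternative Kirchhoff's
-- equations, whose matrix is the symmetric Laplacian, are solvable, and any two
-- solutions differ by a constant.  A pendant vertex a with neighbour b satisfies
-- r(a,y) = 1 + r(b,y), and moving the leaves v₁,…,vₛ from v to u changes no
-- resistance between two non-leaves.  Writing D_R as Σ_{x,y} d(x) r(x,y) over ordered
-- pairs and comparing G with G′ column by column gives
--   D_R(G) - D_R(G′) = s (Σ_{x∈O} d(x) + d(u) - 1 + 2|O|),
-- where O consists of the vertices other than u, v and the leaves.  This is positive
-- because d(u) ≥ 1 and the cycle through u contains a vertex of O.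

module Submission where

open import Algebra.Bundles using (Ring)
import Algebra.Properties.Group as GroupProperties
import Algebra.Properties.Semiring.Sum as SemiringSum
open import Data.Bool using (Bool; true; false; if_then_else_)
open import Data.Bool.Properties using (∧-zeroʳ; ∨-identityʳ; ∧-identityʳ)
open import Data.Empty using (⊥-elim)
open import Data.Fin using (Fin; zero; suc; _≟_; _<?_; fromℕ; inject₁)
import Data.Fin.Properties as Finₚ
import Data.Integer as ℤ
import Data.Integer.Properties as ℤₚ
import Data.Nat as ℕ
open import Data.Nat using (ℕ; zero; suc; _≤_; z≤n; s≤s)
import Data.Nat.Coprimality as Coprime
import Data.Nat.Properties as ℕₚ
open import Data.Product using (∃; _×_; _,_; proj₁; proj₂; uncurry)
import Data.Rational as ℚ
open import Data.Rational using (ℚ; 0ℚ; 1ℚ; _+_; _-_; _*_; _/_; -_; 1/_; _<_)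
import Data.Rational.Properties as ℚₚ
open import Data.Rational.Solver using (module +-*-Solver)
import Data.Sum as Sum
open import Data.Sum using (_⊎_; inj₁; inj₂)
open import Function using (_∘_)
open import Relation.Binary using (tri<; tri≈; tri>)
open import Relation.Binary.PropositionalEquality
  using (_≡_; _≢_; refl; sym; trans; cong; cong₂; subst; module ≡-Reasoning)
open import Relation.Nullary using (¬_; yes; no)
open import Relation.Nullary.Decidable using (⌊_⌋; toSum)

open import Defs hiding (sym)

open ≡-Reasoning
open +-*-Solver using (solve; _:+_; _:*_; _:-_; :-_; _:=_; con)
open SemiringSum (Ring.semiring ℚₚ.+-*-ring)
  using (sum; sum-cong-≗; sum-replicate-zero; ∑-distrib-+; ∑-comm; *-distribˡ-sum)

sumℚ≡sum : ∀ n (f : Fin n → ℚ) → sumℚ n f ≡ sum f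
sumℚ≡sum zero    f = refl
sumℚ≡sum (suc n) f = cong (f zero +_) (sumℚ≡sum n (λ i → f (suc i)))

sum-cong : ∀ n {f g : Fin n → ℚ} → (∀ i → f i ≡ g i) → sumℚ n f ≡ sumℚ n g
sum-cong n {f} {g} f≗g rewrite sumℚ≡sum n f | sumℚ≡sum n g = sum-cong-≗ f≗g

sum-zero : ∀ n → sumℚ n (λ _ → 0ℚ) ≡ 0ℚ
sum-zero n rewrite sumℚ≡sum n (λ _ → 0ℚ) = sum-replicate-zero n

sum-+ : ∀ n (f g : Fin n → ℚ) → sumℚ n (λ i → f i + g i) ≡ sumℚ n f + sumℚ n g
sum-+ n f g rewrite sumℚ≡sum n (λ i → f i + g i) | sumℚ≡sum n f | sumℚ≡sum n g =
  ∑-distrib-+ f g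

sum-*ˡ : ∀ n c (f : Fin n → ℚ) → sumℚ n (λ i → c * f i) ≡ c * sumℚ n f
sum-*ˡ n c f rewrite sumℚ≡sum n (λ i → c * f i) | sumℚ≡sum n f = sym (*-distribˡ-sum c f)

sum-*ʳ : ∀ n c (f : Fin n → ℚ) → sumℚ n (λ i → f i * c) ≡ sumℚ n f * c
sum-*ʳ n c f = begin
  sumℚ n (λ i → f i * c) ≡⟨ sum-cong n (λ i → ℚₚ.*-comm (f i) c) ⟩
  sumℚ n (λ i → c * f i) ≡⟨ sum-*ˡ n c f ⟩
  c * sumℚ n f           ≡⟨ ℚₚ.*-comm c _ ⟩
  sumℚ n f * c           ∎

sum-neg : ∀ n (f : Fin n → ℚ) → sumℚ n (λ i → - f i) ≡ - sumℚ n f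
sum-neg zero    f = refl
sum-neg (suc n) f =
  trans (cong (- f zero +_) (sum-neg n (λ i → f (suc i)))) (sym (ℚₚ.neg-distrib-+ (f zero) _))

sum-- : ∀ n (f g : Fin n → ℚ) → sumℚ n (λ i → f i - g i) ≡ sumℚ n f - sumℚ n g
sum-- n f g = trans (sum-+ n f (λ i → - g i)) (cong (sumℚ n f +_) (sum-neg n g))

sum-comm : ∀ m n (f : Fin m → Fin n → ℚ) →
  sumℚ m (λ i → sumℚ n (f i)) ≡ sumℚ n (λ j → sumℚ m (λ i → f i j))
sum-comm m n f = begin
  sumℚ m (λ i → sumℚ n (f i))      ≡⟨ sumℚ≡sum m _ ⟩
  sum (λ i → sumℚ n (f i))         ≡⟨ sum-cong-≗ (λ i → sumℚ≡sum n (f i)) ⟩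
  sum (λ i → sum (f i))            ≡⟨ ∑-comm f ⟩
  sum (λ j → sum (λ i → f i j))    ≡⟨ sum-cong-≗ (λ j → sumℚ≡sum m (λ i → f i j)) ⟨
  sum (λ j → sumℚ m (λ i → f i j)) ≡⟨ sumℚ≡sum n _ ⟨
  sumℚ n (λ j → sumℚ m (λ i → f i j)) ∎

sum-concentrated : ∀ n (f : Fin n → ℚ) a → (∀ i → i ≢ a → f i ≡ 0ℚ) → sumℚ n f ≡ f a
sum-concentrated (suc n) f zero f≡0 = begin
  f zero + sumℚ n (λ i → f (suc i)) ≡⟨ cong (f zero +_) (sum-cong n (λ i → f≡0 (suc i) λ ())) ⟩
  f zero + sumℚ n (λ _ → 0ℚ)        ≡⟨ cong (f zero +_) (sum-zero n) ⟩
  f zero + 0ℚ                       ≡⟨ ℚₚ.+-identityʳ _ ⟩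
  f zero                            ∎
sum-concentrated (suc n) f (suc a) f≡0 = begin
  f zero + sumℚ n (λ i → f (suc i)) ≡⟨ cong (_+ sumℚ n (λ i → f (suc i))) (f≡0 zero λ ()) ⟩
  0ℚ + sumℚ n (λ i → f (suc i))     ≡⟨ ℚₚ.+-identityˡ _ ⟩
  sumℚ n (λ i → f (suc i))          ≡⟨ sum-concentrated n _ a (λ i → f≡0 (suc i) ∘ (_∘ Finₚ.suc-injective)) ⟩
  f (suc a)                         ∎

sum-nonneg : ∀ n (f : Fin n → ℚ) → (∀ i → 0ℚ ℚ.≤ f i) → 0ℚ ℚ.≤ sumℚ n f
sum-nonneg zero    f f≥0 = ℚₚ.≤-refl
sum-nonneg (suc n) f f≥0 = ℚₚ.+-mono-≤ (f≥0 zero) (sum-nonneg n _ (λ i → f≥0 (suc i)))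

term≤sum : ∀ n (f : Fin n → ℚ) → (∀ i → 0ℚ ℚ.≤ f i) → ∀ a → f a ℚ.≤ sumℚ n f
term≤sum (suc n) f f≥0 zero =
  subst (ℚ._≤ f zero + sumℚ n (λ i → f (suc i))) (ℚₚ.+-identityʳ (f zero))
    (ℚₚ.+-monoʳ-≤ (f zero) (sum-nonneg n _ (λ i → f≥0 (suc i))))
term≤sum (suc n) f f≥0 (suc a) =
  subst (ℚ._≤ f zero + sumℚ n (λ i → f (suc i))) (ℚₚ.+-identityˡ (f (suc a)))
    (ℚₚ.+-mono-≤ (f≥0 zero) (term≤sum n _ (λ i → f≥0 (suc i)) a))

nonneg-sum≡0 : ∀ n (f : Fin n → ℚ) → (∀ i → 0ℚ ℚ.≤ f i) → sumℚ n f ≡ 0ℚ → ∀ a → f a ≡ 0ℚ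
nonneg-sum≡0 n f f≥0 Σf≡0 a = ℚₚ.≤-antisym (subst (f a ℚ.≤_) Σf≡0 (term≤sum n f f≥0 a)) (f≥0 a)

≟-true : ∀ {n} {a b : Fin n} → a ≡ b → ⌊ a ≟ b ⌋ ≡ true
≟-true {a = a} {b} a≡b with a ≟ b
... | yes _   = refl
... | no a≢b = ⊥-elim (a≢b a≡b)

≟-false : ∀ {n} {a b : Fin n} → a ≢ b → ⌊ a ≟ b ⌋ ≡ false
≟-false {a = a} {b} a≢b with a ≟ b
... | yes a≡b = ⊥-elim (a≢b a≡b)
... | no _    = refl

δ-refl : ∀ {n} (a : Fin n) → δ a a ≡ 1ℚ
δ-refl a rewrite ≟-true {a = a} refl = refl

δ-≢ : ∀ {n} {a b : Fin n} → a ≢ b → δ a b ≡ 0ℚ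
δ-≢ a≢b rewrite ≟-false a≢b = refl

δ-sym : ∀ {n} (a b : Fin n) → δ a b ≡ δ b a
δ-sym a b with a ≟ b
... | yes refl = sym (δ-refl a)
... | no a≢b   = sym (δ-≢ (a≢b ∘ sym))

sum-δ : ∀ n (f : Fin n → ℚ) k → sumℚ n (λ i → δ i k * f i) ≡ f k
sum-δ n f k = begin
  sumℚ n (λ i → δ i k * f i) ≡⟨ sum-concentrated n _ k δf≡0 ⟩
  δ k k * f k                ≡⟨ cong (_* f k) (δ-refl k) ⟩
  1ℚ * f k                   ≡⟨ ℚₚ.*-identityˡ (f k) ⟩
  f k                        ∎
  where
  δf≡0 : ∀ i → i ≢ k → δ i k * f i ≡ 0ℚ
  δf≡0 i i≢k = trans (cong (_* f i) (δ-≢ i≢k)) (ℚₚ.*-zeroˡ (f i))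

sum-δ-const : ∀ n (k : Fin n) → sumℚ n (λ i → δ i k) ≡ 1ℚ
sum-δ-const n k = trans (sum-concentrated n _ k (λ i → δ-≢)) (δ-refl k)

b2ℚ : Bool → ℚ
b2ℚ true  = 1ℚ
b2ℚ false = 0ℚ

b2ℚ-nonneg : ∀ b → 0ℚ ℚ.≤ b2ℚ b
b2ℚ-nonneg true  = ℚₚ.<⇒≤ (ℚₚ.positive⁻¹ 1ℚ)
b2ℚ-nonneg false = ℚₚ.≤-refl

p≤q⇒0≤q-p : ∀ {p q} → p ℚ.≤ q → 0ℚ ℚ.≤ q - p
p≤q⇒0≤q-p {p} {q} p≤q = subst (ℚ._≤ q - p) (ℚₚ.+-inverseʳ p) (ℚₚ.+-monoˡ-≤ (- p) p≤q)

p-q≡0⇒p≡q : ∀ {p q} → p - q ≡ 0ℚ → p ≡ q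
p-q≡0⇒p≡q {p} {q} = GroupProperties.x∙y⁻¹≈ε⇒x≈y ℚₚ.+-0-group p q

-- The Laplacian and harmonic functions

laplacian : ∀ {n} → Graph n → (Fin n → ℚ) → Fin n → ℚ
laplacian {n} G φ z = sumℚ n (λ w → if adj G z w then φ z - φ w else 0ℚ)

Harmonic : ∀ {n} → Graph n → (Fin n → ℚ) → Set
Harmonic G h = ∀ z → laplacian G h z ≡ 0ℚ

laplacian-+ : ∀ {n} (G : Graph n) φ ψ z →
  laplacian G (λ t → φ t + ψ t) z ≡ laplacian G φ z + laplacian G ψ z
laplacian-+ {n} G φ ψ z = trans (sum-cong n edge) (sum-+ n _ _)
  where
  edge : ∀ w → (if adj G z w then (φ z + ψ z) - (φ w + ψ w) else 0ℚ)
             ≡ (if adj G z w then φ z - φ w else 0ℚ) + (if adj G z w then ψ z - ψ w else 0ℚ)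
  edge w with adj G z w
  ... | true  = solve 4 (λ a b c d → (a :+ c) :- (b :+ d) := (a :- b) :+ (c :- d)) refl
                  (φ z) (φ w) (ψ z) (ψ w)
  ... | false = sym (ℚₚ.+-identityˡ 0ℚ)

laplacian-neg : ∀ {n} (G : Graph n) φ z → laplacian G (λ t → - φ t) z ≡ - laplacian G φ z
laplacian-neg {n} G φ z = trans (sum-cong n edge) (sum-neg n _)
  where
  edge : ∀ w → (if adj G z w then - φ z - - φ w else 0ℚ) ≡ - (if adj G z w then φ z - φ w else 0ℚ)
  edge w with adj G z w
  ... | true  = solve 2 (λ a b → (:- a) :- (:- b) := :- (a :- b)) refl (φ z) (φ w)
  ... | false = refl

laplacian-- : ∀ {n} (G : Graph n) φ ψ z →
  laplacian G (λ t → φ t - ψ t) z ≡ laplacian G φ z - laplacian G ψ z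
laplacian-- G φ ψ z =
  trans (laplacian-+ G φ (λ t → - ψ t) z) (cong (laplacian G φ z +_) (laplacian-neg G ψ z))

max-attained : ∀ n (f : Fin (suc n) → ℚ) → ∃ λ m → ∀ i → f i ℚ.≤ f m
max-attained zero    f = zero , λ { zero → ℚₚ.≤-refl }
max-attained (suc n) f with max-attained n (f ∘ suc)
... | m , f≤fm with ℚₚ.≤-total (f zero) (f (suc m))
...   | inj₁ f0≤fm = suc m , λ { zero → f0≤fm ; (suc i) → f≤fm i }
...   | inj₂ fm≤f0 = zero  , λ { zero → ℚₚ.≤-refl ; (suc i) → ℚₚ.≤-trans (f≤fm i) fm≤f0 }

module _ {n} (G : Graph n) {h : Fin n → ℚ} (harmonic : Harmonic G h) where

  -- At a maximum the Laplacian is a sum of nonnegative terms, so each term vanishes.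
  harmonic-max-neighbour : ∀ {m} → (∀ i → h i ℚ.≤ h m) → ∀ {w} → Adj G m w → h w ≡ h m
  harmonic-max-neighbour {m} h≤hm {w} m~w =
    sym (p-q≡0⇒p≡q (subst (λ b → (if b then h m - h w else 0ℚ) ≡ 0ℚ) m~w
                      (nonneg-sum≡0 n _ term-nonneg (harmonic m) w)))
    where
    term-nonneg : ∀ w → 0ℚ ℚ.≤ (if adj G m w then h m - h w else 0ℚ)
    term-nonneg w with adj G m w
    ... | true  = p≤q⇒0≤q-p (h≤hm w)
    ... | false = ℚₚ.≤-refl

  harmonic-max-walk : ∀ {m} → (∀ i → h i ℚ.≤ h m) → ∀ {a b} → Walk G a b → h a ≡ h m → h b ≡ h m
  harmonic-max-walk h≤hm []           ha≡hm = ha≡hm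
  harmonic-max-walk h≤hm (a~c ∷ walk) ha≡hm =
    harmonic-max-walk h≤hm walk
      (trans (harmonic-max-neighbour (λ i → subst (h i ℚ.≤_) (sym ha≡hm) (h≤hm i)) a~c) ha≡hm)

harmonic-constant : ∀ {n} (G : Graph n) → Connected G → ∀ h → Harmonic G h → ∀ x y → h x ≡ h y
harmonic-constant {suc n} G connected h harmonic x y with max-attained n h
... | m , h≤hm = trans (to-max x) (sym (to-max y))
  where
  to-max : ∀ z → h z ≡ h m
  to-max z = harmonic-max-walk G harmonic h≤hm (connected m z) refl

-- The Fredholm alternative over ℚ

module _ {m n : ℕ} (A : Fin m → Fin n → ℚ) (b : Fin m → ℚ) where

  Solution : (Fin n → ℚ) → Set
  Solution x = ∀ i → sumℚ n (λ j → A i j * x j) ≡ b i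

  Obstruction : (Fin m → ℚ) → Set
  Obstruction y = (∀ j → sumℚ m (λ i → y i * A i j) ≡ 0ℚ) × sumℚ m (λ i → y i * b i) ≢ 0ℚ

all-zero-or-nonzero : ∀ m (f : Fin m → ℚ) → (∀ i → f i ≡ 0ℚ) ⊎ ∃ λ i → f i ≢ 0ℚ
all-zero-or-nonzero m f with Finₚ.all? (λ i → f i ℚ.≟ 0ℚ)
... | yes f≡0 = inj₁ f≡0
... | no ¬f≡0 = inj₂ (Finₚ.¬∀⟶∃¬ m _ (λ i → f i ℚ.≟ 0ℚ) ¬f≡0)

fredholm-no-unknowns : ∀ m (A : Fin m → Fin 0 → ℚ) b → ∃ (Solution A b) ⊎ ∃ (Obstruction A b)
fredholm-no-unknowns m A b with all-zero-or-nonzero m b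
... | inj₁ b≡0          = inj₁ ((λ ()) , λ i → sym (b≡0 i))
... | inj₂ (k , bk≢0) =
  inj₂ ((λ i → δ i k) , (λ ()) , λ δ·b≡0 → bk≢0 (trans (sym (sum-δ m b k)) δ·b≡0))

module ZeroColumn {m n} (A : Fin m → Fin (suc n) → ℚ) (b : Fin m → ℚ)
                  (column₀≡0 : ∀ i → A i zero ≡ 0ℚ) where

  A⁺ : Fin m → Fin n → ℚ
  A⁺ i j = A i (suc j)

  extend-solution : ∃ (Solution A⁺ b) → ∃ (Solution A b)
  extend-solution (x , solves) = (λ { zero → 0ℚ ; (suc j) → x j }) , solves⁺
    where
    solves⁺ : ∀ i → A i zero * 0ℚ + sumℚ n (λ j → A⁺ i j * x j) ≡ b i
    solves⁺ i = trans (cong (_+ sumℚ n (λ j → A⁺ i j * x j)) (ℚₚ.*-zeroʳ (A i zero)))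
                      (trans (ℚₚ.+-identityˡ _) (solves i))

  lift-obstruction : ∃ (Obstruction A⁺ b) → ∃ (Obstruction A b)
  lift-obstruction (y , y⊥A⁺ , y·b≢0) = y , (λ { zero → y⊥column₀ ; (suc j) → y⊥A⁺ j }) , y·b≢0
    where
    y⊥column₀ : sumℚ m (λ i → y i * A i zero) ≡ 0ℚ
    y⊥column₀ = trans (sum-cong m (λ i → trans (cong (y i *_) (column₀≡0 i)) (ℚₚ.*-zeroʳ (y i))))
                      (sum-zero m)

module EliminationStep {m n} (A : Fin m → Fin (suc n) → ℚ) (b : Fin m → ℚ)
                       (k : Fin m) (pivot≢0 : A k zero ≢ 0ℚ) where

  pivot⁻¹ : ℚ
  pivot⁻¹ = (1/ A k zero) {{ℚ.≢-nonZero pivot≢0}}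

  c : Fin m → ℚ
  c i = A i zero * pivot⁻¹

  A′ : Fin m → Fin n → ℚ
  A′ i j = A i (suc j) - c i * A k (suc j)

  b′ : Fin m → ℚ
  b′ i = b i - c i * b k

  back-substitute : ∃ (Solution A′ b′) → ∃ (Solution A b)
  back-substitute (x , solves) = x⁺ , solves⁺
    where
    S : Fin m → ℚ
    S i = sumℚ n (λ j → A i (suc j) * x j)

    x⁺ : Fin (suc n) → ℚ
    x⁺ zero    = (b k - S k) * pivot⁻¹
    x⁺ (suc j) = x j

    reduced-row : ∀ i → sumℚ n (λ j → A′ i j * x j) ≡ S i - c i * S k
    reduced-row i = begin
      sumℚ n (λ j → A′ i j * x j)
        ≡⟨ sum-cong n (λ j → solve 4 (λ a c a′ x → (a :- c :* a′) :* x := a :* x :- c :* (a′ :* x))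
                               refl (A i (suc j)) (c i) (A k (suc j)) (x j)) ⟩
      sumℚ n (λ j → A i (suc j) * x j - c i * (A k (suc j) * x j))
        ≡⟨ sum-- n _ _ ⟩
      S i - sumℚ n (λ j → c i * (A k (suc j) * x j))
        ≡⟨ cong (λ q → S i - q) (sum-*ˡ n (c i) _) ⟩
      S i - c i * S k ∎

    solves⁺ : Solution A b x⁺
    solves⁺ i = begin
      A i zero * ((b k - S k) * pivot⁻¹) + S i
        ≡⟨ solve 5 (λ a bk sk p si → a :* ((bk :- sk) :* p) :+ si := (si :- (a :* p) :* sk) :+ (a :* p) :* bk)
             refl (A i zero) (b k) (S k) pivot⁻¹ (S i) ⟩
      (S i - c i * S k) + c i * b k ≡⟨ cong (_+ c i * b k) (trans (sym (reduced-row i)) (solves i)) ⟩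
      (b i - c i * b k) + c i * b k ≡⟨ solve 2 (λ p q → (p :- q) :+ q := p) refl (b i) (c i * b k) ⟩
      b i                           ∎

  lift-obstruction : ∃ (Obstruction A′ b′) → ∃ (Obstruction A b)
  lift-obstruction (y′ , y′⊥A′ , y′·b′≢0) = y , y⊥A , y·b≢0
    where
    t : ℚ
    t = sumℚ m (λ i → y′ i * c i)

    y : Fin m → ℚ
    y i = y′ i - δ i k * t

    pair-y : ∀ f → sumℚ m (λ i → y i * f i) ≡ sumℚ m (λ i → y′ i * f i) - t * f k
    pair-y f = begin
      sumℚ m (λ i → y i * f i)
        ≡⟨ sum-cong m (λ i → solve 4 (λ a d t f → (a :- d :* t) :* f := a :* f :- d :* (t :* f))
                               refl (y′ i) (δ i k) t (f i)) ⟩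
      sumℚ m (λ i → y′ i * f i - δ i k * (t * f i))
        ≡⟨ sum-- m _ _ ⟩
      sumℚ m (λ i → y′ i * f i) - sumℚ m (λ i → δ i k * (t * f i))
        ≡⟨ cong (λ q → sumℚ m (λ i → y′ i * f i) - q) (sum-δ m (λ i → t * f i) k) ⟩
      sumℚ m (λ i → y′ i * f i) - t * f k ∎

    pair-eliminated : ∀ f g → sumℚ m (λ i → y′ i * (f i - c i * g)) ≡ sumℚ m (λ i → y′ i * f i) - t * g
    pair-eliminated f g = begin
      sumℚ m (λ i → y′ i * (f i - c i * g))
        ≡⟨ sum-cong m (λ i → solve 4 (λ y f c g → y :* (f :- c :* g) := y :* f :- (y :* c) :* g)
                               refl (y′ i) (f i) (c i) g) ⟩
      sumℚ m (λ i → y′ i * f i - y′ i * c i * g)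
        ≡⟨ sum-- m _ _ ⟩
      sumℚ m (λ i → y′ i * f i) - sumℚ m (λ i → y′ i * c i * g)
        ≡⟨ cong (λ q → sumℚ m (λ i → y′ i * f i) - q) (sum-*ʳ m g (λ i → y′ i * c i)) ⟩
      sumℚ m (λ i → y′ i * f i) - t * g ∎

    column₀ : ∀ i → A i zero ≡ c i * A k zero
    column₀ i = begin
      A i zero                        ≡⟨ ℚₚ.*-identityʳ _ ⟨
      A i zero * 1ℚ                   ≡⟨ cong (A i zero *_) pivot⁻¹*pivot ⟨
      A i zero * (pivot⁻¹ * A k zero) ≡⟨ ℚₚ.*-assoc (A i zero) pivot⁻¹ (A k zero) ⟨
      c i * A k zero                  ∎
      where pivot⁻¹*pivot = ℚₚ.*-inverseˡ (A k zero) {{ℚ.≢-nonZero pivot≢0}}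

    y⊥A : ∀ j → sumℚ m (λ i → y i * A i j) ≡ 0ℚ
    y⊥A zero = begin
      sumℚ m (λ i → y i * A i zero)                ≡⟨ pair-y _ ⟩
      sumℚ m (λ i → y′ i * A i zero) - t * A k zero ≡⟨ cong (_- t * A k zero) y′·column₀ ⟩
      t * A k zero - t * A k zero                  ≡⟨ ℚₚ.+-inverseʳ (t * A k zero) ⟩
      0ℚ                                           ∎
      where
      y′·column₀ : sumℚ m (λ i → y′ i * A i zero) ≡ t * A k zero
      y′·column₀ = trans
        (sum-cong m (λ i → trans (cong (y′ i *_) (column₀ i)) (sym (ℚₚ.*-assoc (y′ i) (c i) (A k zero)))))
        (sum-*ʳ m (A k zero) (λ i → y′ i * c i))
    y⊥A (suc j) = trans (pair-y _) (trans (sym (pair-eliminated _ _)) (y′⊥A′ j))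

    y·b≢0 : sumℚ m (λ i → y i * b i) ≢ 0ℚ
    y·b≢0 y·b≡0 = y′·b′≢0 (trans (pair-eliminated b (b k)) (trans (sym (pair-y b)) y·b≡0))

fredholm-alternative : ∀ m n (A : Fin m → Fin n → ℚ) b → ∃ (Solution A b) ⊎ ∃ (Obstruction A b)
fredholm-alternative m zero    A b = fredholm-no-unknowns m A b
fredholm-alternative m (suc n) A b with all-zero-or-nonzero m (λ i → A i zero)
... | inj₁ column₀≡0 = Sum.map extend-solution lift-obstruction (fredholm-alternative m n A⁺ b)
  where open ZeroColumn A b column₀≡0
... | inj₂ (k , pivot≢0) = Sum.map back-substitute lift-obstruction (fredholm-alternative m n A′ b′)
  where open EliminationStep A b k pivot≢0

-- Effective resistance

degℚ : ∀ {n} → Graph n → Fin n → ℚ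
degℚ {n} G z = sumℚ n (λ w → b2ℚ (adj G z w))

laplacianMatrix : ∀ {n} → Graph n → Fin n → Fin n → ℚ
laplacianMatrix G z w = δ z w * degℚ G z - b2ℚ (adj G z w)

laplacianMatrix-sym : ∀ {n} (G : Graph n) z w → laplacianMatrix G z w ≡ laplacianMatrix G w z
laplacianMatrix-sym G z w = cong₂ (λ d e → d - b2ℚ e) diagonal (Graph.sym G z w)
  where
  diagonal : δ z w * degℚ G z ≡ δ w z * degℚ G w
  diagonal with z ≟ w
  ... | yes refl = cong (_* degℚ G z) (sym (δ-refl z))
  ... | no z≢w   = trans (ℚₚ.*-zeroˡ (degℚ G z))
                     (sym (trans (cong (_* degℚ G w) (δ-≢ (z≢w ∘ sym))) (ℚₚ.*-zeroˡ (degℚ G w))))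

laplacian-via-degree : ∀ {n} (G : Graph n) φ z →
  laplacian G φ z ≡ φ z * degℚ G z - sumℚ n (λ w → b2ℚ (adj G z w) * φ w)
laplacian-via-degree {n} G φ z = begin
  laplacian G φ z
    ≡⟨ sum-cong n edge ⟩
  sumℚ n (λ w → φ z * b2ℚ (adj G z w) - b2ℚ (adj G z w) * φ w)
    ≡⟨ sum-- n _ _ ⟩
  sumℚ n (λ w → φ z * b2ℚ (adj G z w)) - sumℚ n (λ w → b2ℚ (adj G z w) * φ w)
    ≡⟨ cong (_- sumℚ n (λ w → b2ℚ (adj G z w) * φ w)) (sum-*ˡ n (φ z) _) ⟩
  φ z * degℚ G z - sumℚ n (λ w → b2ℚ (adj G z w) * φ w) ∎
  where
  edge : ∀ w → (if adj G z w then φ z - φ w else 0ℚ) ≡ φ z * b2ℚ (adj G z w) - b2ℚ (adj G z w) * φ w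
  edge w with adj G z w
  ... | true  = solve 2 (λ p q → p :- q := p :* con 1ℚ :- con 1ℚ :* q) refl (φ z) (φ w)
  ... | false = solve 2 (λ p q → con 0ℚ := p :* con 0ℚ :- con 0ℚ :* q) refl (φ z) (φ w)

laplacianMatrix-apply : ∀ {n} (G : Graph n) φ z →
  sumℚ n (λ w → laplacianMatrix G z w * φ w) ≡ laplacian G φ z
laplacianMatrix-apply {n} G φ z = begin
  sumℚ n (λ w → laplacianMatrix G z w * φ w)
    ≡⟨ sum-cong n (λ w → solve 4 (λ d D a f → (d :* D :- a) :* f := d :* (D :* f) :- a :* f)
                           refl (δ z w) (degℚ G z) (b2ℚ (adj G z w)) (φ w)) ⟩
  sumℚ n (λ w → δ z w * (degℚ G z * φ w) - b2ℚ (adj G z w) * φ w)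
    ≡⟨ sum-- n _ _ ⟩
  sumℚ n (λ w → δ z w * (degℚ G z * φ w)) - Σaφ
    ≡⟨ cong (_- Σaφ) (trans (sum-cong n (λ w → cong (_* (degℚ G z * φ w)) (δ-sym z w)))
                            (sum-δ n (λ w → degℚ G z * φ w) z)) ⟩
  degℚ G z * φ z - Σaφ
    ≡⟨ cong (_- Σaφ) (ℚₚ.*-comm (degℚ G z) (φ z)) ⟩
  φ z * degℚ G z - Σaφ
    ≡⟨ laplacian-via-degree G φ z ⟨
  laplacian G φ z ∎
  where
  Σaφ = sumℚ n (λ w → b2ℚ (adj G z w) * φ w)

left-kernel-harmonic : ∀ {n} (G : Graph n) h →
  (∀ w → sumℚ n (λ z → h z * laplacianMatrix G z w) ≡ 0ℚ) → Harmonic G h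
left-kernel-harmonic {n} G h h⊥L w = begin
  laplacian G h w                            ≡⟨ laplacianMatrix-apply G h w ⟨
  sumℚ n (λ z → laplacianMatrix G w z * h z) ≡⟨ sum-cong n transpose ⟩
  sumℚ n (λ z → h z * laplacianMatrix G z w) ≡⟨ h⊥L w ⟩
  0ℚ                                         ∎
  where
  transpose : ∀ z → laplacianMatrix G w z * h z ≡ h z * laplacianMatrix G z w
  transpose z = trans (cong (_* h z) (laplacianMatrix-sym G w z)) (ℚₚ.*-comm _ (h z))

sum-*-current : ∀ n (h : Fin n → ℚ) x y → sumℚ n (λ i → h i * (δ i x - δ i y)) ≡ h x - h y
sum-*-current n h x y = begin
  sumℚ n (λ i → h i * (δ i x - δ i y))
    ≡⟨ sum-cong n (λ i → solve 3 (λ h p q → h :* (p :- q) := p :* h :- q :* h) refl (h i) (δ i x) (δ i y)) ⟩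
  sumℚ n (λ i → δ i x * h i - δ i y * h i)
    ≡⟨ sum-- n _ _ ⟩
  sumℚ n (λ i → δ i x * h i) - sumℚ n (λ i → δ i y * h i)
    ≡⟨ cong₂ _-_ (sum-δ n h x) (sum-δ n h y) ⟩
  h x - h y ∎

-- An obstruction to Kirchhoff's equations would be harmonic, hence constant, yet
-- separate x from y.
resistance-exists : ∀ {n} (G : Graph n) → Connected G → ∀ x y → ∃ (IsResistance G x y)
resistance-exists {n} G connected x y
  with fredholm-alternative n n (laplacianMatrix G) (λ z → δ z x - δ z y)
... | inj₁ (φ , solves) =
  (φ x - φ y) , φ , (λ z → trans (sym (laplacianMatrix-apply G φ z)) (solves z)) , refl
... | inj₂ (h , h⊥L , h·current≢0) = ⊥-elim (h·current≢0 (begin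
  sumℚ n (λ i → h i * (δ i x - δ i y)) ≡⟨ sum-*-current n h x y ⟩
  h x - h y ≡⟨ cong (_- h y) (harmonic-constant G connected h (left-kernel-harmonic G h h⊥L) x y) ⟩
  h y - h y ≡⟨ ℚₚ.+-inverseʳ (h y) ⟩
  0ℚ        ∎))

resistance-unique : ∀ {n} (G : Graph n) → Connected G →
  ∀ {x y r₁ r₂} → IsResistance G x y r₁ → IsResistance G x y r₂ → r₁ ≡ r₂
resistance-unique G connected {x} {y} (φ , kφ , refl) (ψ , kψ , refl) = begin
  φ x - φ y                       ≡⟨ solve 4 (λ a b c d → a :- b := (c :- d) :+ ((a :- c) :- (b :- d)))
                                       refl (φ x) (φ y) (ψ x) (ψ y) ⟩
  (ψ x - ψ y) + (d x - d y)       ≡⟨ cong (λ t → (ψ x - ψ y) + (t - d y))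
                                       (harmonic-constant G connected d d-harmonic x y) ⟩
  (ψ x - ψ y) + (d y - d y)       ≡⟨ cong ((ψ x - ψ y) +_) (ℚₚ.+-inverseʳ (d y)) ⟩
  (ψ x - ψ y) + 0ℚ                ≡⟨ ℚₚ.+-identityʳ _ ⟩
  ψ x - ψ y                       ∎
  where
  d : _ → ℚ
  d t = φ t - ψ t
  d-harmonic : Harmonic G d
  d-harmonic z =
    trans (laplacian-- G φ ψ z) (trans (cong₂ _-_ (kφ z) (kψ z)) (ℚₚ.+-inverseʳ (δ z x - δ z y)))

resistance-self : ∀ {n} (G : Graph n) x → IsResistance G x x 0ℚ
resistance-self {n} G x = (λ _ → 0ℚ) , (λ z → trans (no-flow z) (sym (ℚₚ.+-inverseʳ (δ z x)))) , refl
  where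
  no-flow : ∀ z → laplacian G (λ _ → 0ℚ) z ≡ 0ℚ
  no-flow z = trans (sum-cong n edge) (sum-zero n)
    where
    edge : ∀ w → (if adj G z w then 0ℚ - 0ℚ else 0ℚ) ≡ 0ℚ
    edge w with adj G z w
    ... | true  = refl
    ... | false = refl

resistance-sym : ∀ {n} (G : Graph n) {x y r} → IsResistance G x y r → IsResistance G y x r
resistance-sym G {x} {y} (φ , kφ , refl) =
  (λ t → - φ t) , kirchhoff , solve 2 (λ a b → a :- b := (:- b) :- (:- a)) refl (φ x) (φ y)
  where
  kirchhoff : ∀ z → laplacian G (λ t → - φ t) z ≡ δ z y - δ z x
  kirchhoff z = trans (laplacian-neg G φ z)
    (trans (cong -_ (kφ z)) (solve 2 (λ a b → :- (a :- b) := b :- a) refl (δ z x) (δ z y)))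

adj-≢ : ∀ {n} (G : Graph n) {a b} → Adj G a b → a ≢ b
adj-≢ G {a} a~b refl with trans (sym a~b) (Graph.irrefl G a)
... | ()

sum-unique-neighbour : ∀ {n} (G : Graph n) {a b} → (∀ w → Adj G a w → w ≡ b) → Adj G a b →
  (f : Fin n → ℚ) → sumℚ n (λ w → if adj G a w then f w else 0ℚ) ≡ f b
sum-unique-neighbour {n} G {a} {b} only-b a~b f =
  trans (sum-concentrated n (λ w → if adj G a w then f w else 0ℚ) b elsewhere)
        (cong (λ e → if e then f b else 0ℚ) a~b)
  where
  elsewhere : ∀ w → w ≢ b → (if adj G a w then f w else 0ℚ) ≡ 0ℚ
  elsewhere w w≢b with adj G a w in a~w
  ... | true  = ⊥-elim (w≢b (only-b w a~w))
  ... | false = refl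

module Pendant {n} (G : Graph n) {a b : Fin n} (a~b : Adj G a b) (only-b : ∀ w → Adj G a w → w ≡ b) where

  degℚ-pendant : degℚ G a ≡ 1ℚ
  degℚ-pendant = trans (sum-cong n as-if) (sum-unique-neighbour G only-b a~b (λ _ → 1ℚ))
    where
    as-if : ∀ w → b2ℚ (adj G a w) ≡ (if adj G a w then 1ℚ else 0ℚ)
    as-if w with adj G a w
    ... | true  = refl
    ... | false = refl

  potential-pendant : ∀ {φ} → laplacian G φ a ≡ 0ℚ → φ a ≡ φ b
  potential-pendant {φ} no-flow =
    p-q≡0⇒p≡q (trans (sym (sum-unique-neighbour G only-b a~b (λ w → φ a - φ w))) no-flow)

  laplacian-δ : ∀ z → laplacian G (λ t → δ t a) z ≡ δ z a - δ z b
  laplacian-δ z with toSum (z ≟ a)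
  ... | inj₁ refl = begin
    laplacian G (λ t → δ t a) a ≡⟨ sum-unique-neighbour G only-b a~b (λ w → δ a a - δ w a) ⟩
    δ a a - δ b a               ≡⟨ cong (λ q → δ a a - q) (δ-sym b a) ⟩
    δ a a - δ a b               ∎
  ... | inj₂ z≢a = begin
    laplacian G (λ t → δ t a) z                 ≡⟨ sum-cong n edge ⟩
    sumℚ n (λ w → - (δ w a * b2ℚ (adj G z w)))  ≡⟨ sum-neg n _ ⟩
    - sumℚ n (λ w → δ w a * b2ℚ (adj G z w))    ≡⟨ cong -_ (sum-δ n _ a) ⟩
    - b2ℚ (adj G z a)                           ≡⟨ cong -_ adjacent-to-a ⟩
    - δ z b                                     ≡⟨ ℚₚ.+-identityˡ (- δ z b) ⟨
    0ℚ - δ z b                                  ≡⟨ cong (_- δ z b) (δ-≢ z≢a) ⟨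
    δ z a - δ z b                               ∎
    where
    edge : ∀ w → (if adj G z w then δ z a - δ w a else 0ℚ) ≡ - (δ w a * b2ℚ (adj G z w))
    edge w with adj G z w
    ... | true  = trans (cong (_- δ w a) (δ-≢ z≢a))
                        (solve 1 (λ d → con 0ℚ :- d := :- (d :* con 1ℚ)) refl (δ w a))
    ... | false = cong -_ (sym (ℚₚ.*-zeroʳ (δ w a)))
    adjacent-to-a : b2ℚ (adj G z a) ≡ δ z b
    adjacent-to-a with toSum (z ≟ b)
    ... | inj₁ refl = trans (cong b2ℚ (trans (Graph.sym G z a) a~b)) (sym (δ-refl z))
    ... | inj₂ z≢b with adj G z a in z~a
    ...   | true  = ⊥-elim (z≢b (only-b z (trans (Graph.sym G a z) z~a)))
    ...   | false = sym (δ-≢ z≢b)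

  resistance-pendant : ∀ {y ρ} → a ≢ y → IsResistance G b y ρ → IsResistance G a y (1ℚ + ρ)
  resistance-pendant {y} a≢y (φ , kφ , refl) = ψ , kψ , value
    where
    ψ : Fin n → ℚ
    ψ t = φ t + δ t a

    kψ : ∀ z → laplacian G ψ z ≡ δ z a - δ z y
    kψ z = begin
      laplacian G ψ z                               ≡⟨ laplacian-+ G φ (λ t → δ t a) z ⟩
      laplacian G φ z + laplacian G (λ t → δ t a) z ≡⟨ cong₂ _+_ (kφ z) (laplacian-δ z) ⟩
      (δ z b - δ z y) + (δ z a - δ z b)             ≡⟨ solve 3 (λ p q r → (q :- r) :+ (p :- q) := p :- r)
                                                         refl (δ z a) (δ z b) (δ z y) ⟩
      δ z a - δ z y                                 ∎

    φa≡φb : φ a ≡ φ b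
    φa≡φb = potential-pendant (trans (kφ a) (cong₂ _-_ (δ-≢ (adj-≢ G a~b)) (δ-≢ a≢y)))

    value : 1ℚ + (φ b - φ y) ≡ ψ a - ψ y
    value = begin
      1ℚ + (φ b - φ y)        ≡⟨ cong (λ t → 1ℚ + (t - φ y)) φa≡φb ⟨
      1ℚ + (φ a - φ y)        ≡⟨ solve 3 (λ o p q → o :+ (p :- q) := (p :+ o) :- (q :+ con 0ℚ))
                                   refl 1ℚ (φ a) (φ y) ⟩
      (φ a + 1ℚ) - (φ y + 0ℚ) ≡⟨ cong₂ (λ s t → (φ a + s) - (φ y + t)) (δ-refl a) (δ-≢ (a≢y ∘ sym)) ⟨
      ψ a - ψ y               ∎

ℕtoℚ-+ : ∀ a b → ℕtoℚ (a ℕ.+ b) ≡ ℕtoℚ a + ℕtoℚ b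
ℕtoℚ-+ a b = sym (trans (cong₂ _+_ (as-mkℚ a) (as-mkℚ b))
  (cong (_/ 1) (cong₂ ℤ._+_ (ℤₚ.*-identityʳ (ℤ.+ a)) (ℤₚ.*-identityʳ (ℤ.+ b)))))
  where
  as-mkℚ : ∀ k → ℕtoℚ k ≡ ℚ.mkℚ (ℤ.+ k) 0 (Coprime.sym (Coprime.1-coprimeTo k))
  as-mkℚ k = ℚₚ.normalize-coprime (Coprime.sym (Coprime.1-coprimeTo k))

count≡sum : ∀ m (f : Fin m → Bool) → ℕtoℚ (sumℕ m (λ w → b2ℕ (f w))) ≡ sumℚ m (λ w → b2ℚ (f w))
count≡sum zero    f = refl
count≡sum (suc m) f =
  trans (ℕtoℚ-+ (b2ℕ (f zero)) _) (cong₂ _+_ (b2ℕ≡b2ℚ (f zero)) (count≡sum m (f ∘ suc)))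
  where
  b2ℕ≡b2ℚ : ∀ e → ℕtoℚ (b2ℕ e) ≡ b2ℚ e
  b2ℕ≡b2ℚ true  = refl
  b2ℕ≡b2ℚ false = refl

deg≡degℚ : ∀ {n} (G : Graph n) x → ℕtoℚ (deg G x) ≡ degℚ G x
deg≡degℚ {n} G x = count≡sum n (adj G x)

count≥1 : ∀ m (f : Fin m → Bool) {a} → f a ≡ true → 1 ≤ sumℕ m (λ w → b2ℕ (f w))
count≥1 (suc m) f {zero}  fa rewrite fa = s≤s z≤n
count≥1 (suc m) f {suc a} fa = ℕₚ.≤-trans (count≥1 m (f ∘ suc) fa) (ℕₚ.m≤n+m _ (b2ℕ (f zero)))

count≥2 : ∀ m (f : Fin m → Bool) {a b} → a ≢ b → f a ≡ true → f b ≡ true →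
  2 ≤ sumℕ m (λ w → b2ℕ (f w))
count≥2 (suc m) f {zero}  {zero}  a≢b _  _  = ⊥-elim (a≢b refl)
count≥2 (suc m) f {zero}  {suc b} _   fa fb rewrite fa = s≤s (count≥1 m (f ∘ suc) fb)
count≥2 (suc m) f {suc a} {zero}  _   fa fb rewrite fb = s≤s (count≥1 m (f ∘ suc) fa)
count≥2 (suc m) f {suc a} {suc b} a≢b fa fb =
  ℕₚ.≤-trans (count≥2 m (f ∘ suc) (a≢b ∘ cong suc) fa fb) (ℕₚ.m≤n+m _ (b2ℕ (f zero)))

deg≡1-unique-neighbour : ∀ {n} (G : Graph n) {a b} → deg G a ≡ 1 → Adj G a b → ∀ w → Adj G a w → w ≡ b
deg≡1-unique-neighbour G {a} {b} deg≡1 a~b w a~w with toSum (w ≟ b)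
... | inj₁ w≡b = w≡b
... | inj₂ w≢b with subst (2 ≤_) deg≡1 (count≥2 _ (adj G a) w≢b a~w a~b)
...   | s≤s ()

-- The degree resistance distance as a sum over ordered pairs

sum-pairs : ∀ n (F : Fin n → Fin n → ℚ) → (∀ x → F x x ≡ 0ℚ) →
  sumℚ n (λ x → sumℚ n (λ y → if ⌊ x <? y ⌋ then F x y + F y x else 0ℚ)) ≡
  sumℚ n (λ x → sumℚ n (F x))
sum-pairs n F F-diag = begin
  sumℚ n (λ x → sumℚ n (λ y → if ⌊ x <? y ⌋ then F x y + F y x else 0ℚ))
    ≡⟨ sum-cong n (λ x → trans (sum-cong n (split x)) (sum-+ n _ _)) ⟩
  sumℚ n (λ x → sumℚ n (above x) + sumℚ n (λ y → if ⌊ x <? y ⌋ then F y x else 0ℚ))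
    ≡⟨ sum-+ n _ _ ⟩
  ΣΣ above + sumℚ n (λ x → sumℚ n (λ y → if ⌊ x <? y ⌋ then F y x else 0ℚ))
    ≡⟨ cong (ΣΣ above +_) (sum-comm n n _) ⟩
  ΣΣ above + ΣΣ below
    ≡⟨ sum-+ n _ _ ⟨
  sumℚ n (λ x → sumℚ n (above x) + sumℚ n (below x))
    ≡⟨ sum-cong n (λ x → trans (sym (sum-+ n (above x) (below x))) (sum-cong n (merge x))) ⟩
  sumℚ n (λ x → sumℚ n (F x)) ∎
  where
  above below : Fin n → Fin n → ℚ
  above x y = if ⌊ x <? y ⌋ then F x y else 0ℚ
  below x y = if ⌊ y <? x ⌋ then F x y else 0ℚ
  ΣΣ : (Fin n → Fin n → ℚ) → ℚ
  ΣΣ H = sumℚ n (λ x → sumℚ n (H x))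
  split : ∀ x y → (if ⌊ x <? y ⌋ then F x y + F y x else 0ℚ)
                ≡ above x y + (if ⌊ x <? y ⌋ then F y x else 0ℚ)
  split x y with x <? y
  ... | yes _ = refl
  ... | no _  = sym (ℚₚ.+-identityˡ 0ℚ)
  merge : ∀ x y → above x y + below x y ≡ F x y
  merge x y with x <? y | y <? x
  ... | yes x<y | yes y<x = ⊥-elim (Finₚ.<-asym x<y y<x)
  ... | yes _   | no _    = ℚₚ.+-identityʳ _
  ... | no _    | yes _   = ℚₚ.+-identityˡ _
  ... | no x≮y  | no y≮x with Finₚ.<-cmp x y
  ...   | tri< x<y _ _  = ⊥-elim (x≮y x<y)
  ...   | tri> _ _ y<x  = ⊥-elim (y≮x y<x)
  ...   | tri≈ _ refl _ = sym (F-diag x)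

DRsum-ordered : ∀ {n} (G : Graph n) (r : Fin n → Fin n → ℚ) →
  (∀ x → r x x ≡ 0ℚ) → (∀ x y → r x y ≡ r y x) →
  DRsum G r ≡ sumℚ n (λ x → sumℚ n (λ y → degℚ G x * r x y))
DRsum-ordered {n} G r r-diag r-sym = trans (sum-cong n (λ x → sum-cong n (pair x))) (sum-pairs n F F-diag)
  where
  F : Fin n → Fin n → ℚ
  F x y = degℚ G x * r x y
  F-diag : ∀ x → F x x ≡ 0ℚ
  F-diag x = trans (cong (degℚ G x *_) (r-diag x)) (ℚₚ.*-zeroʳ (degℚ G x))
  pair : ∀ x y → (if ⌊ x <? y ⌋ then ℕtoℚ (deg G x ℕ.+ deg G y) * r x y else 0ℚ)
               ≡ (if ⌊ x <? y ⌋ then F x y + F y x else 0ℚ)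
  pair x y = cong (if ⌊ x <? y ⌋ then_else 0ℚ) (begin
    ℕtoℚ (deg G x ℕ.+ deg G y) * r x y              ≡⟨ cong (_* r x y) (ℕtoℚ-+ (deg G x) (deg G y)) ⟩
    (ℕtoℚ (deg G x) + ℕtoℚ (deg G y)) * r x y       ≡⟨ cong₂ (λ d e → (d + e) * r x y)
                                                           (deg≡degℚ G x) (deg≡degℚ G y) ⟩
    (degℚ G x + degℚ G y) * r x y                   ≡⟨ ℚₚ.*-distribʳ-+ (r x y) (degℚ G x) (degℚ G y) ⟩
    degℚ G x * r x y + degℚ G y * r x y             ≡⟨ cong (λ t → F x y + degℚ G y * t) (r-sym x y) ⟩
    F x y + F y x                                   ∎)

DR-exists : ∀ {n} (G : Graph n) → Connected G → ∃ (IsDR G)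
DR-exists G connected = DRsum G r , r , r-res , refl
  where
  r : _ → _ → ℚ
  r x y = proj₁ (resistance-exists G connected x y)
  r-res : ∀ x y → IsResistance G x y (r x y)
  r-res x y = proj₂ (resistance-exists G connected x y)

fromℕ-or-inject₁ : ∀ k (i : Fin (suc k)) → i ≡ fromℕ k ⊎ ∃ λ j → i ≡ inject₁ j
fromℕ-or-inject₁ zero    zero    = inj₁ refl
fromℕ-or-inject₁ (suc k) zero    = inj₂ (zero , refl)
fromℕ-or-inject₁ (suc k) (suc i) = Sum.map (cong suc) (λ { (j , i≡j) → suc j , cong suc i≡j })
                                            (fromℕ-or-inject₁ k i)

cycle-neighbour : ∀ {n} {G : Graph n} {p} (C : Cycle G p) {z} → OnCycle C z →
  ∃ λ w → Adj G z w × OnCycle C w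
cycle-neighbour C (i , refl) with fromℕ-or-inject₁ (k C) i
... | inj₁ refl       = vert C zero , close C , zero , refl
... | inj₂ (j , refl) = vert C (suc j) , step C j , suc j , refl

pendant-off-cycle : ∀ {n} {G : Graph n} {p} (C : Cycle G p) {a b} →
  ¬ OnCycle C b → (∀ w → Adj G a w → w ≡ b) → ¬ OnCycle C a
pendant-off-cycle C b∉C only-b a∈C with cycle-neighbour C a∈C
... | w , a~w , w∈C = b∉C (subst (OnCycle C) (only-b w a~w) w∈C)

isLeaf-sound : ∀ {n s} (vs : Fin s → Fin n) {z} → isLeaf vs z ≡ true → ∃ λ i → z ≡ vs i
isLeaf-sound {s = suc s} vs {z} leaf with z ≟ vs zero
... | yes z≡vs₀ = zero , z≡vs₀
... | no _ with isLeaf-sound (vs ∘ suc) leaf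
...   | i , z≡vsᵢ = suc i , z≡vsᵢ

isLeaf-complete : ∀ {n s} (vs : Fin s → Fin n) i → isLeaf vs (vs i) ≡ true
isLeaf-complete vs zero rewrite ≟-true {a = vs zero} refl = refl
isLeaf-complete vs (suc i) with vs (suc i) ≟ vs zero
... | yes _ = refl
... | no _  = isLeaf-complete (vs ∘ suc) i

isLeaf-false : ∀ {n s} (vs : Fin s → Fin n) {z} → (∀ i → z ≢ vs i) → isLeaf vs z ≡ false
isLeaf-false vs {z} z∉vs with isLeaf vs z in leaf
... | false = refl
... | true  = ⊥-elim (uncurry z∉vs (isLeaf-sound vs leaf))

true-or-false : ∀ b → b ≡ true ⊎ b ≡ false
true-or-false true  = inj₁ refl
true-or-false false = inj₂ refl

-- Moving the leaves from v to u

module PendantShift {n} (G : Graph n) (connected : Connected G)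
  {s} (u v : Fin n) (vs : Fin s → Fin n) (leaf₀ : Fin s)
  (v~u : Adj G v u) (v~vs : ∀ i → Adj G v (vs i))
  (v-neighbours : ∀ z → Adj G v z → z ≡ u ⊎ ∃ λ i → z ≡ vs i)
  (deg-vs : ∀ i → deg G (vs i) ≡ 1)
  (u∉vs : ∀ i → u ≢ vs i)
  {c : Fin n} (c≢u : c ≢ u) (c≢v : c ≢ v) (c∉vs : ∀ i → c ≢ vs i)
  where

  L : Fin n → Bool
  L = isLeaf vs

  G′ : Graph n
  G′ = σ G u v vs

  u~v : Adj G u v
  u~v = trans (Graph.sym G u v) v~u

  u≢v : u ≢ v
  u≢v = adj-≢ G u~v

  leaf~v : ∀ {z} → L z ≡ true → Adj G z v
  leaf~v leaf with isLeaf-sound vs leaf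
  ... | i , refl = trans (Graph.sym G (vs i) v) (v~vs i)

  leaf-neighbour : ∀ {z} → L z ≡ true → ∀ w → Adj G z w → w ≡ v
  leaf-neighbour leaf with isLeaf-sound vs leaf
  ... | i , refl = deg≡1-unique-neighbour G (deg-vs i) (leaf~v leaf)

  u-core : L u ≡ false
  u-core = isLeaf-false vs u∉vs

  v-core : L v ≡ false
  v-core = isLeaf-false vs (λ i → adj-≢ G (v~vs i))

  leaf≢core : ∀ {a b} → L a ≡ true → L b ≡ false → a ≢ b
  leaf≢core leaf core refl with trans (sym leaf) core
  ... | ()

  adj-leaf : ∀ {x w} → x ≢ v → L w ≡ true → adj G x w ≡ false
  adj-leaf {x} {w} x≢v leaf with adj G x w in x~w
  ... | false = refl
  ... | true  = ⊥-elim (x≢v (leaf-neighbour leaf x (trans (Graph.sym G w x) x~w)))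

  adj′-core : ∀ {x y} → L x ≡ false → L y ≡ false → adj G′ x y ≡ adj G x y
  adj′-core {x} {y} x-core y-core
    rewrite x-core | y-core
          | ∧-zeroʳ ⌊ x ≟ v ⌋ | ∧-zeroʳ ⌊ y ≟ v ⌋ | ∧-zeroʳ ⌊ x ≟ u ⌋ | ∧-zeroʳ ⌊ y ≟ u ⌋ =
    trans (∨-identityʳ _) (∧-identityʳ _)

  leaf~′u : ∀ {z} → L z ≡ true → Adj G′ z u
  leaf~′u {z} leaf
    rewrite trans (Graph.sym G z u) (adj-leaf u≢v leaf) | leaf | u-core
          | ≟-false (leaf≢core leaf u-core) | ≟-true {a = u} refl = refl

  adj′-leaf : ∀ {z w} → L z ≡ true → w ≢ u → adj G′ z w ≡ false
  adj′-leaf {z} {w} leaf w≢u with true-or-false (adj G z w)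
  ... | inj₂ z≁w rewrite z≁w | leaf | ≟-false (leaf≢core leaf u-core) | ≟-false w≢u = refl
  ... | inj₁ z~w with leaf-neighbour leaf w z~w
  ...   | refl rewrite z~w | leaf | v-core | ≟-false (leaf≢core leaf u-core) | ≟-false (leaf≢core leaf v-core)
                     | ≟-true {a = v} refl | ≟-false (u≢v ∘ sym) = refl

  leaf-neighbour′ : ∀ {z} → L z ≡ true → ∀ w → Adj G′ z w → w ≡ u
  leaf-neighbour′ leaf w z~′w with toSum (w ≟ u)
  ... | inj₁ w≡u = w≡u
  ... | inj₂ w≢u with trans (sym z~′w) (adj′-leaf leaf w≢u)
  ...   | ()

  v~′u : Adj G′ v u
  v~′u = trans (adj′-core v-core u-core) v~u

  adj′-v-leaf : ∀ {w} → L w ≡ true → adj G′ v w ≡ false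
  adj′-v-leaf {w} leaf
    rewrite leaf | v-core | ≟-true {a = v} refl | ≟-false (u≢v ∘ sym) | ≟-false (leaf≢core leaf u-core)
          | ∧-zeroʳ (adj G v w) = refl

  v-neighbour′ : ∀ w → Adj G′ v w → w ≡ u
  v-neighbour′ w v~′w with toSum (w ≟ u)
  ... | inj₁ w≡u = w≡u
  ... | inj₂ w≢u with true-or-false (L w)
  ...   | inj₁ leaf with trans (sym v~′w) (adj′-v-leaf leaf)
  ...     | ()
  v-neighbour′ w v~′w | inj₂ w≢u | inj₂ core with v-neighbours w (trans (sym (adj′-core v-core core)) v~′w)
  ...     | inj₁ w≡u = w≡u
  ...     | inj₂ (i , refl) with trans (sym (isLeaf-complete vs i)) core
  ...       | ()

  u~′leaf : ∀ {w} → L w ≡ true → Adj G′ u w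
  u~′leaf {w} leaf = trans (Graph.sym G′ u w) (leaf~′u leaf)

  adj′-other-leaf : ∀ {x w} → L x ≡ false → x ≢ u → x ≢ v → L w ≡ true → adj G′ x w ≡ false
  adj′-other-leaf x-core x≢u x≢v leaf
    rewrite adj-leaf x≢v leaf | x-core | leaf | ≟-false x≢u | ≟-false (leaf≢core leaf u-core) = refl

  walk′ : ∀ {a b} → Walk G a b → Walk G′ a b
  walk′ [] = []
  walk′ (_∷_ {x = a} {y = b} a~b walk) with L a in la | L b in lb
  ... | false | false = trans (adj′-core la lb) a~b ∷ walk′ walk
  ... | true  | _ with leaf-neighbour la b a~b
  ...   | refl = leaf~′u la ∷ (trans (adj′-core u-core v-core) u~v ∷ walk′ walk)
  walk′ (_∷_ {x = a} {y = b} a~b walk) | false | true with leaf-neighbour lb a (trans (Graph.sym G b a) a~b)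
  ...   | refl = v~′u ∷ (u~′leaf lb ∷ walk′ walk)

  connected′ : Connected G′
  connected′ x y = walk′ (connected x y)

  Λ : ℚ
  Λ = sumℚ n (λ z → b2ℚ (L z))

  degℚ-leaf : ∀ {z} → L z ≡ true → degℚ G z ≡ 1ℚ
  degℚ-leaf leaf = Pendant.degℚ-pendant G (leaf~v leaf) (leaf-neighbour leaf)

  degℚ′-leaf : ∀ {z} → L z ≡ true → degℚ G′ z ≡ 1ℚ
  degℚ′-leaf leaf = Pendant.degℚ-pendant G′ (leaf~′u leaf) (leaf-neighbour′ leaf)

  degℚ′-v : degℚ G′ v ≡ 1ℚ
  degℚ′-v = Pendant.degℚ-pendant G′ v~′u v-neighbour′

  degℚ-v : degℚ G v ≡ 1ℚ + Λ
  degℚ-v = trans (sum-cong n edge) (trans (sum-+ n _ _) (cong (_+ Λ) (sum-δ-const n u)))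
    where
    edge : ∀ w → b2ℚ (adj G v w) ≡ δ w u + b2ℚ (L w)
    edge w with toSum (w ≟ u)
    ... | inj₁ refl rewrite v~u | u-core | δ-refl u = sym (ℚₚ.+-identityʳ 1ℚ)
    ... | inj₂ w≢u with true-or-false (L w)
    ...   | inj₁ leaf with isLeaf-sound vs leaf
    ...     | i , refl rewrite v~vs i | leaf | δ-≢ w≢u = sym (ℚₚ.+-identityˡ 1ℚ)
    edge w | inj₂ w≢u | inj₂ core with true-or-false (adj G v w)
    ...     | inj₂ v≁w rewrite v≁w | core | δ-≢ w≢u = sym (ℚₚ.+-identityˡ 0ℚ)
    ...     | inj₁ v~w with v-neighbours w v~w
    ...       | inj₁ w≡u       = ⊥-elim (w≢u w≡u)
    ...       | inj₂ (i , refl) with trans (sym (isLeaf-complete vs i)) core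
    ...         | ()

  degℚ′-u : degℚ G′ u ≡ degℚ G u + Λ
  degℚ′-u = trans (sum-cong n edge) (sum-+ n _ _)
    where
    edge : ∀ w → b2ℚ (adj G′ u w) ≡ b2ℚ (adj G u w) + b2ℚ (L w)
    edge w with true-or-false (L w)
    ... | inj₁ leaf rewrite u~′leaf leaf | adj-leaf u≢v leaf | leaf = sym (ℚₚ.+-identityˡ 1ℚ)
    ... | inj₂ core rewrite adj′-core u-core core | core = sym (ℚₚ.+-identityʳ _)

  degℚ′-other : ∀ {x} → L x ≡ false → x ≢ u → x ≢ v → degℚ G′ x ≡ degℚ G x
  degℚ′-other {x} x-core x≢u x≢v = sum-cong n edge
    where
    edge : ∀ w → b2ℚ (adj G′ x w) ≡ b2ℚ (adj G x w)
    edge w with true-or-false (L w)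
    ... | inj₁ leaf rewrite adj′-other-leaf x-core x≢u x≢v leaf | adj-leaf x≢v leaf = refl
    ... | inj₂ core rewrite adj′-core x-core core = refl

  -- A current between two non-leaves does not enter the leaves, which therefore sit
  -- at the potential of their attachment vertex; re-attaching them to u at the
  -- potential of u leaves Kirchhoff's equations intact.
  resistance-core : ∀ {x y ρ} → L x ≡ false → L y ≡ false → IsResistance G x y ρ → IsResistance G′ x y ρ
  resistance-core {x} {y} x-core y-core (φ , kφ , refl) =
    ψ , kψ , cong₂ _-_ (sym (ψ-core x-core)) (sym (ψ-core y-core))
    where
    φ-leaf : ∀ {l} → L l ≡ true → φ l ≡ φ v
    φ-leaf leaf = Pendant.potential-pendant G (leaf~v leaf) (leaf-neighbour leaf)
      (trans (kφ _) (cong₂ _-_ (δ-≢ (leaf≢core leaf x-core)) (δ-≢ (leaf≢core leaf y-core))))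

    ψ : Fin n → ℚ
    ψ z = if L z then φ u else φ z

    ψ-core : ∀ {z} → L z ≡ false → ψ z ≡ φ z
    ψ-core core rewrite core = refl

    ψ-leaf : ∀ {z} → L z ≡ true → ψ z ≡ φ u
    ψ-leaf leaf rewrite leaf = refl

    kψ-leaf : ∀ {z} → L z ≡ true → laplacian G′ ψ z ≡ δ z x - δ z y
    kψ-leaf {z} leaf = begin
      laplacian G′ ψ z ≡⟨ sum-unique-neighbour G′ (leaf-neighbour′ leaf) (leaf~′u leaf) (λ w → ψ z - ψ w) ⟩
      ψ z - ψ u        ≡⟨ cong₂ _-_ (ψ-leaf leaf) (ψ-core u-core) ⟩
      φ u - φ u        ≡⟨ ℚₚ.+-inverseʳ (φ u) ⟩
      0ℚ - 0ℚ          ≡⟨ cong₂ _-_ (δ-≢ (leaf≢core leaf x-core)) (δ-≢ (leaf≢core leaf y-core)) ⟨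
      δ z x - δ z y    ∎

    kψ-v : laplacian G′ ψ v ≡ δ v x - δ v y
    kψ-v = begin
      laplacian G′ ψ v ≡⟨ sum-unique-neighbour G′ v-neighbour′ v~′u (λ w → ψ v - ψ w) ⟩
      ψ v - ψ u        ≡⟨ cong₂ _-_ (ψ-core v-core) (ψ-core u-core) ⟩
      φ v - φ u        ≡⟨ trans (sum-concentrated n _ u only-u)
                                  (cong (λ e → if e then φ v - φ u else 0ℚ) v~u) ⟨
      laplacian G φ v  ≡⟨ kφ v ⟩
      δ v x - δ v y    ∎
      where
      only-u : ∀ w → w ≢ u → (if adj G v w then φ v - φ w else 0ℚ) ≡ 0ℚ
      only-u w w≢u with true-or-false (adj G v w)
      ... | inj₂ v≁w = cong (λ e → if e then φ v - φ w else 0ℚ) v≁w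
      ... | inj₁ v~w with v-neighbours w v~w
      ...   | inj₁ w≡u       = ⊥-elim (w≢u w≡u)
      ...   | inj₂ (i , refl) = trans (cong (λ e → if e then φ v - φ (vs i) else 0ℚ) v~w)
          (trans (cong (λ t → φ v - t) (φ-leaf (isLeaf-complete vs i))) (ℚₚ.+-inverseʳ (φ v)))

    kψ-other : ∀ {z} → L z ≡ false → z ≢ v → laplacian G′ ψ z ≡ δ z x - δ z y
    kψ-other {z} core z≢v = trans (sum-cong n edge) (kφ z)
      where
      edge : ∀ w → (if adj G′ z w then ψ z - ψ w else 0ℚ) ≡ (if adj G z w then φ z - φ w else 0ℚ)
      edge w with true-or-false (L w)
      ... | inj₂ w-core = trans (cong (λ e → if e then ψ z - ψ w else 0ℚ) (adj′-core core w-core))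
                                (cong (λ t → if adj G z w then t else 0ℚ) (cong₂ _-_ (ψ-core core) (ψ-core w-core)))
      ... | inj₁ leaf = trans at-leaf (sym (cong (λ e → if e then φ z - φ w else 0ℚ) (adj-leaf z≢v leaf)))
        where
        at-leaf : (if adj G′ z w then ψ z - ψ w else 0ℚ) ≡ 0ℚ
        at-leaf with true-or-false (adj G′ z w)
        ... | inj₂ z≁′w = cong (λ e → if e then ψ z - ψ w else 0ℚ) z≁′w
        ... | inj₁ z~′w = trans (cong (λ e → if e then ψ z - ψ w else 0ℚ) z~′w)
            (trans (cong₂ _-_ (trans (ψ-core core) (cong φ (leaf-neighbour′ leaf z w~′z))) (ψ-leaf leaf))
                   (ℚₚ.+-inverseʳ (φ u)))
          where w~′z = trans (Graph.sym G′ w z) z~′w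

    kψ : ∀ z → laplacian G′ ψ z ≡ δ z x - δ z y
    kψ z with true-or-false (L z)
    ... | inj₁ leaf = kψ-leaf leaf
    ... | inj₂ core with toSum (z ≟ v)
    ...   | inj₁ refl = kψ-v
    ...   | inj₂ z≢v  = kψ-other core z≢v

  data VertexClass (x : Fin n) : Set where
    leaf  : L x ≡ true → VertexClass x
    is-v  : x ≡ v → VertexClass x
    is-u  : x ≡ u → VertexClass x
    other : L x ≡ false → x ≢ u → x ≢ v → VertexClass x

  classify : ∀ x → VertexClass x
  classify x with true-or-false (L x)
  ... | inj₁ lx = leaf lx
  ... | inj₂ x-core with toSum (x ≟ v)
  ...   | inj₁ x≡v = is-v x≡v
  ...   | inj₂ x≢v with toSum (x ≟ u)
  ...     | inj₁ x≡u = is-u x≡u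
  ...     | inj₂ x≢u = other x-core x≢u x≢v

  -- The indicator function of the set O of vertices other than u, v and the leaves.
  κ : Fin n → ℚ
  κ x = ((1ℚ - b2ℚ (L x)) - δ x u) - δ x v

  κ-leaf : ∀ {x} → L x ≡ true → κ x ≡ 0ℚ
  κ-leaf lx rewrite lx | δ-≢ (leaf≢core lx u-core) | δ-≢ (leaf≢core lx v-core) = refl

  κ-v : κ v ≡ 0ℚ
  κ-v rewrite v-core | δ-≢ (u≢v ∘ sym) | δ-refl v = refl

  κ-u : κ u ≡ 0ℚ
  κ-u rewrite u-core | δ-≢ u≢v | δ-refl u = refl

  κ-other : ∀ {x} → L x ≡ false → x ≢ u → x ≢ v → κ x ≡ 1ℚ
  κ-other x-core x≢u x≢v rewrite x-core | δ-≢ x≢u | δ-≢ x≢v = refl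

  ω : Fin n → ℚ
  ω y = κ y + (δ y u - δ y v)

  ω-leaf : ∀ {y} → L y ≡ true → ω y ≡ 0ℚ
  ω-leaf ly rewrite κ-leaf ly | δ-≢ (leaf≢core ly u-core) | δ-≢ (leaf≢core ly v-core) = refl

  κ-nonneg : ∀ x → 0ℚ ℚ.≤ κ x
  κ-nonneg x with classify x
  ... | leaf lx               = ℚₚ.≤-reflexive (sym (κ-leaf lx))
  ... | is-v refl             = ℚₚ.≤-reflexive (sym κ-v)
  ... | is-u refl             = ℚₚ.≤-reflexive (sym κ-u)
  ... | other x-core x≢u x≢v = subst (0ℚ ℚ.≤_) (sym (κ-other x-core x≢u x≢v)) (b2ℚ-nonneg true)

  module Comparison (r r′ : Fin n → Fin n → ℚ)
    (r-res : ∀ x y → IsResistance G x y (r x y)) (r′-res : ∀ x y → IsResistance G′ x y (r′ x y)) where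

    r-diag : ∀ x → r x x ≡ 0ℚ
    r-diag x = resistance-unique G connected (r-res x x) (resistance-self G x)

    r′-diag : ∀ x → r′ x x ≡ 0ℚ
    r′-diag x = resistance-unique G′ connected′ (r′-res x x) (resistance-self G′ x)

    r-sym : ∀ x y → r x y ≡ r y x
    r-sym x y = resistance-unique G connected (r-res x y) (resistance-sym G (r-res y x))

    r′-sym : ∀ x y → r′ x y ≡ r′ y x
    r′-sym x y = resistance-unique G′ connected′ (r′-res x y) (resistance-sym G′ (r′-res y x))

    r-leaf : ∀ {l y} → L l ≡ true → l ≢ y → r l y ≡ 1ℚ + r v y
    r-leaf {l} {y} ll l≢y = resistance-unique G connected (r-res l y)
      (Pendant.resistance-pendant G (leaf~v ll) (leaf-neighbour ll) l≢y (r-res v y))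

    r′-leaf : ∀ {l y} → L l ≡ true → l ≢ y → r′ l y ≡ 1ℚ + r′ u y
    r′-leaf {l} {y} ll l≢y = resistance-unique G′ connected′ (r′-res l y)
      (Pendant.resistance-pendant G′ (leaf~′u ll) (leaf-neighbour′ ll) l≢y (r′-res u y))

    r′-v : ∀ {y} → v ≢ y → r′ v y ≡ 1ℚ + r′ u y
    r′-v {y} v≢y = resistance-unique G′ connected′ (r′-res v y)
      (Pendant.resistance-pendant G′ v~′u v-neighbour′ v≢y (r′-res u y))

    r≡r′-core : ∀ {x y} → L x ≡ false → L y ≡ false → r x y ≡ r′ x y
    r≡r′-core {x} {y} x-core y-core =
      resistance-unique G′ connected′ (resistance-core x-core y-core (r-res x y)) (r′-res x y)

    r′-vu : r′ v u ≡ 1ℚ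
    r′-vu = trans (r′-v (u≢v ∘ sym)) (trans (cong (1ℚ +_) (r′-diag u)) (ℚₚ.+-identityʳ 1ℚ))

    r-vu : r v u ≡ 1ℚ
    r-vu = trans (r≡r′-core v-core u-core) r′-vu

    gap : Fin n → Fin n → ℚ
    gap x y = degℚ G x * r x y - degℚ G′ x * r′ x y

    module LeafColumn {y} (ly : L y ≡ true) where

      y≢v : y ≢ v
      y≢v = leaf≢core ly v-core

      y≢u : y ≢ u
      y≢u = leaf≢core ly u-core

      r-yv : r y v ≡ 1ℚ
      r-yv = trans (r-leaf ly y≢v) (trans (cong (1ℚ +_) (r-diag v)) (ℚₚ.+-identityʳ 1ℚ))

      r′-yu : r′ y u ≡ 1ℚ
      r′-yu = trans (r′-leaf ly y≢u) (trans (cong (1ℚ +_) (r′-diag u)) (ℚₚ.+-identityʳ 1ℚ))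

      r≡r′-leaf : ∀ {x} → L x ≡ true → r x y ≡ r′ x y
      r≡r′-leaf {x} lx with toSum (x ≟ y)
      ... | inj₁ refl = trans (r-diag x) (sym (r′-diag x))
      ... | inj₂ x≢y  = trans (r-leaf lx x≢y) (trans (cong (1ℚ +_) (trans (r-sym v y) r-yv))
                          (sym (trans (r′-leaf lx x≢y) (cong (1ℚ +_) (trans (r′-sym u y) r′-yu)))))

      r-vy : r v y ≡ 1ℚ
      r-vy = trans (r-sym v y) r-yv

      r′-vy : r′ v y ≡ 1ℚ + 1ℚ
      r′-vy = trans (r′-sym v y) (trans (r′-leaf ly y≢v) (cong (1ℚ +_) (trans (r′-sym u v) r′-vu)))

      r-uy : r u y ≡ 1ℚ + 1ℚ
      r-uy = trans (r-sym u y) (trans (r-leaf ly y≢u) (cong (1ℚ +_) r-vu))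

      r′-uy : r′ u y ≡ 1ℚ
      r′-uy = trans (r′-sym u y) r′-yu

      r-other : ∀ {x} → L x ≡ false → x ≢ v → r x y ≡ 1ℚ + (1ℚ + r′ u x)
      r-other {x} x-core x≢v = trans (r-sym x y) (trans (r-leaf ly (leaf≢core ly x-core))
        (cong (1ℚ +_) (trans (r≡r′-core v-core x-core) (r′-v (x≢v ∘ sym)))))

      r′-other : ∀ {x} → L x ≡ false → r′ x y ≡ 1ℚ + r′ u x
      r′-other {x} x-core = trans (r′-sym x y) (r′-leaf ly (leaf≢core ly x-core))

      gap-entry : ∀ x → gap x y ≡ κ x * degℚ G x + (δ x v * (Λ - 1ℚ) + δ x u * (degℚ G u - Λ))
      gap-entry x with classify x
      ... | leaf lx
        rewrite degℚ-leaf lx | degℚ′-leaf lx | κ-leaf lx | δ-≢ (leaf≢core lx v-core)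
              | δ-≢ (leaf≢core lx u-core) | r≡r′-leaf lx =
        solve 3 (λ a A B → con 1ℚ :* a :- con 1ℚ :* a := con 0ℚ :* con 1ℚ :+ (con 0ℚ :* A :+ con 0ℚ :* B))
          refl (r′ x y) (Λ - 1ℚ) (degℚ G u - Λ)
      ... | is-v refl rewrite degℚ-v | degℚ′-v | κ-v | δ-refl v | δ-≢ (u≢v ∘ sym) | r-vy | r′-vy =
        solve 2 (λ L d → (con 1ℚ :+ L) :* con 1ℚ :- con 1ℚ :* (con 1ℚ :+ con 1ℚ)
                        := con 0ℚ :* (con 1ℚ :+ L) :+ (con 1ℚ :* (L :- con 1ℚ) :+ con 0ℚ :* (d :- L)))
          refl Λ (degℚ G u)
      ... | is-u refl rewrite degℚ′-u | κ-u | δ-refl u | δ-≢ u≢v | r-uy | r′-uy =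
        solve 2 (λ L d → d :* (con 1ℚ :+ con 1ℚ) :- (d :+ L) :* con 1ℚ
                        := con 0ℚ :* d :+ (con 0ℚ :* (L :- con 1ℚ) :+ con 1ℚ :* (d :- L)))
          refl Λ (degℚ G u)
      ... | other x-core x≢u x≢v
        rewrite degℚ′-other x-core x≢u x≢v | κ-other x-core x≢u x≢v | δ-≢ x≢v | δ-≢ x≢u
              | r-other x-core x≢v | r′-other x-core =
        solve 4 (λ d a A B → d :* (con 1ℚ :+ (con 1ℚ :+ a)) :- d :* (con 1ℚ :+ a)
                            := con 1ℚ :* d :+ (con 0ℚ :* A :+ con 0ℚ :* B))
          refl (degℚ G x) (r′ u x) (Λ - 1ℚ) (degℚ G u - Λ)

      column : sumℚ n (λ x → gap x y) ≡ sumℚ n (λ x → κ x * degℚ G x) + ((Λ - 1ℚ) + (degℚ G u - Λ))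
      column = trans (sum-cong n gap-entry) (trans (sum-+ n _ _) (cong (sumℚ n (λ x → κ x * degℚ G x) +_)
        (trans (sum-+ n _ _) (cong₂ _+_ (sum-δ n (λ _ → Λ - 1ℚ) v) (sum-δ n (λ _ → degℚ G u - Λ) u)))))

    module CoreColumn {y} (y-core : L y ≡ false) where

      gap-entry : ∀ x → gap x y ≡ b2ℚ (L x) * (r v y - r u y) + (δ x v * (Λ * r v y) - δ x u * (Λ * r u y))
      gap-entry x with classify x
      ... | leaf lx
        rewrite degℚ-leaf lx | degℚ′-leaf lx | lx | δ-≢ (leaf≢core lx v-core) | δ-≢ (leaf≢core lx u-core)
              | r-leaf lx (leaf≢core lx y-core) | r′-leaf lx (leaf≢core lx y-core)
              | sym (r≡r′-core u-core y-core) =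
        solve 4 (λ a b c d → con 1ℚ :* (con 1ℚ :+ a) :- con 1ℚ :* (con 1ℚ :+ b)
                            := con 1ℚ :* (a :- b) :+ (con 0ℚ :* c :- con 0ℚ :* d))
          refl (r v y) (r u y) (Λ * r v y) (Λ * r u y)
      ... | is-v refl
        rewrite degℚ-v | degℚ′-v | v-core | δ-refl v | δ-≢ (u≢v ∘ sym) | sym (r≡r′-core v-core y-core) =
        solve 3 (λ L a b → (con 1ℚ :+ L) :* a :- con 1ℚ :* a
                          := con 0ℚ :* (a :- b) :+ (con 1ℚ :* (L :* a) :- con 0ℚ :* (L :* b)))
          refl Λ (r v y) (r u y)
      ... | is-u refl
        rewrite degℚ′-u | u-core | δ-refl u | δ-≢ u≢v | sym (r≡r′-core u-core y-core) =
        solve 4 (λ L d a b → d :* b :- (d :+ L) :* b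
                            := con 0ℚ :* (a :- b) :+ (con 0ℚ :* (L :* a) :- con 1ℚ :* (L :* b)))
          refl Λ (degℚ G u) (r v y) (r u y)
      ... | other x-core x≢u x≢v
        rewrite degℚ′-other x-core x≢u x≢v | x-core | δ-≢ x≢v | δ-≢ x≢u
              | sym (r≡r′-core x-core y-core) =
        solve 6 (λ d a b p q t → d :* t :- d :* t := con 0ℚ :* (p :- q) :+ (con 0ℚ :* a :- con 0ℚ :* b))
          refl (degℚ G x) (Λ * r v y) (Λ * r u y) (r v y) (r u y) (r x y)

      r-vy-uy : r v y - r u y ≡ ω y
      r-vy-uy with classify y
      ... | leaf ly    = ⊥-elim (leaf≢core ly y-core refl)
      ... | is-v refl  rewrite r-diag v | r-sym u v | r-vu | κ-v | δ-≢ (u≢v ∘ sym) | δ-refl v = refl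
      ... | is-u refl  rewrite r-diag u | r-vu | κ-u | δ-≢ u≢v | δ-refl u = refl
      ... | other _ y≢u y≢v
        rewrite r≡r′-core v-core y-core | r′-v (y≢v ∘ sym) | sym (r≡r′-core u-core y-core)
              | κ-other y-core y≢u y≢v | δ-≢ y≢u | δ-≢ y≢v =
        solve 1 (λ a → (con 1ℚ :+ a) :- a := con 1ℚ :+ (con 0ℚ :- con 0ℚ)) refl (r u y)

      column : sumℚ n (λ x → gap x y) ≡ (Λ + Λ) * ω y
      column = begin
        sumℚ n (λ x → gap x y)
          ≡⟨ trans (sum-cong n gap-entry) (sum-+ n _ _) ⟩
        sumℚ n (λ x → b2ℚ (L x) * (r v y - r u y)) + sumℚ n (λ x → δ x v * (Λ * r v y) - δ x u * (Λ * r u y))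
          ≡⟨ cong₂ _+_ (sum-*ʳ n _ (λ x → b2ℚ (L x)))
                       (trans (sum-- n _ _) (cong₂ _-_ (sum-δ n _ v) (sum-δ n _ u))) ⟩
        Λ * (r v y - r u y) + (Λ * r v y - Λ * r u y)
          ≡⟨ solve 3 (λ L a b → L :* (a :- b) :+ (L :* a :- L :* b) := (L :+ L) :* (a :- b))
                     refl Λ (r v y) (r u y) ⟩
        (Λ + Λ) * (r v y - r u y)
          ≡⟨ cong ((Λ + Λ) *_) r-vy-uy ⟩
        (Λ + Λ) * ω y ∎

    K : ℚ
    K = sumℚ n κ

    E : ℚ
    E = sumℚ n (λ x → κ x * degℚ G x) + ((Λ - 1ℚ) + (degℚ G u - Λ))

    column : ∀ y → sumℚ n (λ x → gap x y) ≡ b2ℚ (L y) * E + (Λ + Λ) * ω y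
    column y with true-or-false (L y)
    ... | inj₁ ly = begin
      sumℚ n (λ x → gap x y)                ≡⟨ LeafColumn.column ly ⟩
      E                                   ≡⟨ solve 2 (λ e L → e := con 1ℚ :* e :+ (L :+ L) :* con 0ℚ) refl E Λ ⟩
      1ℚ * E + (Λ + Λ) * 0ℚ               ≡⟨ cong₂ (λ e g → b2ℚ e * E + (Λ + Λ) * g) (sym ly) (sym (ω-leaf ly)) ⟩
      b2ℚ (L y) * E + (Λ + Λ) * ω y       ∎
    ... | inj₂ y-core = begin
      sumℚ n (λ x → gap x y)                ≡⟨ CoreColumn.column y-core ⟩
      (Λ + Λ) * ω y                       ≡⟨ ℚₚ.+-identityˡ _ ⟨
      0ℚ + (Λ + Λ) * ω y                  ≡⟨ cong (_+ (Λ + Λ) * ω y) (ℚₚ.*-zeroˡ E) ⟨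
      0ℚ * E + (Λ + Λ) * ω y              ≡⟨ cong (λ e → b2ℚ e * E + (Λ + Λ) * ω y) y-core ⟨
      b2ℚ (L y) * E + (Λ + Λ) * ω y       ∎

    sum-gap : sumℚ n (λ x → sumℚ n (gap x)) ≡ Λ * (E + (K + K))
    sum-gap = begin
      sumℚ n (λ x → sumℚ n (gap x))
        ≡⟨ sum-comm n n gap ⟩
      sumℚ n (λ y → sumℚ n (λ x → gap x y))
        ≡⟨ trans (sum-cong n column) (sum-+ n _ _) ⟩
      sumℚ n (λ y → b2ℚ (L y) * E) + sumℚ n (λ y → (Λ + Λ) * ω y)
        ≡⟨ cong₂ _+_ (sum-*ʳ n E (λ y → b2ℚ (L y))) (trans (sum-*ˡ n (Λ + Λ) ω) (cong ((Λ + Λ) *_) sum-ω)) ⟩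
      Λ * E + (Λ + Λ) * K
        ≡⟨ solve 3 (λ L e k → L :* e :+ (L :+ L) :* k := L :* (e :+ (k :+ k))) refl Λ E K ⟩
      Λ * (E + (K + K)) ∎
      where
      sum-ω : sumℚ n ω ≡ K
      sum-ω = begin
        sumℚ n ω                                               ≡⟨ sum-+ n κ _ ⟩
        K + sumℚ n (λ y → δ y u - δ y v)                       ≡⟨ cong (K +_) (sum-- n _ _) ⟩
        K + (sumℚ n (λ y → δ y u) - sumℚ n (λ y → δ y v))      ≡⟨ cong (λ t → K + t)
                                                                    (cong₂ _-_ (sum-δ-const n u) (sum-δ-const n v)) ⟩
        K + (1ℚ - 1ℚ)                                          ≡⟨ ℚₚ.+-identityʳ K ⟩
        K                                                      ∎

    DR-difference : DRsum G r ≡ DRsum G′ r′ + Λ * (E + (K + K))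
    DR-difference = begin
      DRsum G r                               ≡⟨ solve 2 (λ a b → a := b :+ (a :- b)) refl (DRsum G r) (DRsum G′ r′) ⟩
      DRsum G′ r′ + (DRsum G r - DRsum G′ r′) ≡⟨ cong (DRsum G′ r′ +_) (trans DRsum-gap sum-gap) ⟩
      DRsum G′ r′ + Λ * (E + (K + K))         ∎
      where
      DRsum-gap : DRsum G r - DRsum G′ r′ ≡ sumℚ n (λ x → sumℚ n (gap x))
      DRsum-gap = begin
        DRsum G r - DRsum G′ r′
          ≡⟨ cong₂ _-_ (DRsum-ordered G r r-diag r-sym) (DRsum-ordered G′ r′ r′-diag r′-sym) ⟩
        sumℚ n (λ x → sumℚ n (λ y → degℚ G x * r x y)) - sumℚ n (λ x → sumℚ n (λ y → degℚ G′ x * r′ x y))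
          ≡⟨ trans (sum-cong n (λ x → sum-- n _ _)) (sum-- n _ _) ⟨
        sumℚ n (λ x → sumℚ n (gap x))           ∎

    Λ≥1 : 1ℚ ℚ.≤ Λ
    Λ≥1 = subst (ℚ._≤ Λ) (cong b2ℚ (isLeaf-complete vs leaf₀))
            (term≤sum n _ (λ z → b2ℚ-nonneg (L z)) (vs leaf₀))

    K≥1 : 1ℚ ℚ.≤ K
    K≥1 = subst (ℚ._≤ K) (κ-other (isLeaf-false vs c∉vs) c≢u c≢v) (term≤sum n κ κ-nonneg c)

    E≥0 : 0ℚ ℚ.≤ E
    E≥0 = ℚₚ.+-mono-≤ (sum-nonneg n _ (λ x → κd-nonneg x))
            (subst (0ℚ ℚ.≤_) (solve 2 (λ L d → d :- con 1ℚ := (L :- con 1ℚ) :+ (d :- L)) refl Λ (degℚ G u))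
              (p≤q⇒0≤q-p degu≥1))
      where
      κd-nonneg : ∀ x → 0ℚ ℚ.≤ κ x * degℚ G x
      κd-nonneg x = ℚₚ.nonNegative⁻¹ _
        {{ℚₚ.nonNeg*nonNeg⇒nonNeg (κ x) {{ℚ.nonNegative (κ-nonneg x)}}
                                   (degℚ G x) {{ℚ.nonNegative (sum-nonneg n _ (λ w → b2ℚ-nonneg (adj G x w)))}}}}
      degu≥1 : 1ℚ ℚ.≤ degℚ G u
      degu≥1 = subst (ℚ._≤ degℚ G u) (cong b2ℚ u~v) (term≤sum n _ (λ w → b2ℚ-nonneg (adj G u w)) v)

    DR-decrease : DRsum G′ r′ < DRsum G r
    DR-decrease = subst (DRsum G′ r′ <_) (sym DR-difference)
      (subst (_< DRsum G′ r′ + Λ * (E + (K + K))) (ℚₚ.+-identityʳ (DRsum G′ r′))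
        (ℚₚ.+-monoʳ-< (DRsum G′ r′) gain-positive))
      where
      0<1 : 0ℚ < 1ℚ
      0<1 = ℚₚ.positive⁻¹ 1ℚ
      gain-positive : 0ℚ < Λ * (E + (K + K))
      gain-positive = ℚₚ.positive⁻¹ _
        {{ℚₚ.pos*pos⇒pos Λ {{ℚ.positive (ℚₚ.<-≤-trans 0<1 Λ≥1)}}
                         (E + (K + K)) {{ℚ.positive (ℚₚ.+-mono-≤-< E≥0 (ℚₚ.+-mono-< 0<K 0<K))}}}}
        where 0<K = ℚₚ.<-≤-trans 0<1 K≥1

lemma2p4 : ∀ {n} (G : Graph n) → Bicyclic G →
  (s : ℕ) → 1 ≤ s →
  (p q : ℕ) (Cp : Cycle G p) (Cq : Cycle G q) (w : Fin n) →
  OnCycle Cp w → OnCycle Cq w →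
  (∀ z → OnCycle Cp z → OnCycle Cq z → z ≡ w) →
  (u v : Fin n) (vs : Fin s → Fin n) →
  OnCycle Cq u →
  ¬ OnCycle Cp v → ¬ OnCycle Cq v →
  (∀ i j → vs i ≡ vs j → i ≡ j) →
  (∀ z → z ≡ u ⊎ z ≡ v ⊎ (∃ λ i → z ≡ vs i) ⊎ OnCycle Cp z ⊎ OnCycle Cq z) →
  deg G v ≡ suc s →
  Adj G v u → (∀ i → Adj G v (vs i)) →
  (∀ z → Adj G v z → z ≡ u ⊎ (∃ λ i → z ≡ vs i)) →
  (∀ i → deg G (vs i) ≡ 1) →
  (∃ λ D → IsDR G D) × (∃ λ D′ → IsDR (σ G u v vs) D′) ×
  (∀ D D′ → IsDR G D → IsDR (σ G u v vs) D′ → D′ < D)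
lemma2p4 G (connected , _) s (s≤s z≤n) p q Cp Cq w _ _ _ u v vs u∈Cq _ v∉Cq _ _ _
         v~u v~vs v-neighbours deg-vs =
  DR-exists G connected , DR-exists G′ connected′ ,
  λ { _ _ (r , r-res , refl) (r′ , r′-res , refl) → Comparison.DR-decrease r r′ r-res r′-res }
  where
  -- Of the bicyclic structure only the cycle through u matters: it keeps u off the
  -- leaves and supplies a neighbour c of u other than v and the leaves.
  off-leaves : ∀ {z} → OnCycle Cq z → ∀ i → z ≢ vs i
  off-leaves z∈Cq i refl = pendant-off-cycle Cq v∉Cq
    (deg≡1-unique-neighbour G (deg-vs i) (trans (Graph.sym G (vs i) v) (v~vs i))) z∈Cq

  neighbour : ∃ λ c → Adj G u c × OnCycle Cq c
  neighbour = cycle-neighbour Cq u∈Cq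

  open PendantShift G connected u v vs zero v~u v~vs v-neighbours deg-vs (off-leaves u∈Cq)
    (adj-≢ G (proj₁ (proj₂ neighbour)) ∘ sym)
    (λ c≡v → v∉Cq (subst (OnCycle Cq) c≡v (proj₂ (proj₂ neighbour))))
    (off-leaves (proj₂ (proj₂ neighbour)))
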